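{- Let $A$ be an alphabet and $\eta:A^*\to A^*$ a substitution with growing letter $a\in A$. Let $u=u_0u_1u_2\cdots\in A^{\mathbb{Z}_{\ge0}}$ be a right-infinite periodic point of $\eta$ with $u_0=a$, and let $p\geq1$ be a period of $u$. For every integer $n\geq1$ there exist a unique integer $k=k(n)$ such that $p$ divides $k$ and a unique sequence $(m_i,a_i)_{i=0,\dots,k-1}$ such that (i) this sequence is $a$-admissible and $m_{k-1}m_{k-2}\cdots m_{k-p}\neq\varepsilon$; (ii) $u_0u_1\cdots u_{n-1}=\eta^{k-1}(m_{k-1})\eta^{k-2}(m_{k-2})\cdots\eta^0(m_0)$.
   Context: An alphabet $A$ is a finite set; $A^*$ is the set of finite words, $\varepsilon$ the empty word, $|w|$ the length. A substitution is a morphism $\eta:A^*\to A^*$ such that $\eta(a)$ is nonempty for every $a\in A$ and some letter is growing; a letter $a$ is growing if $|\eta^k(a)|\to\infty$ as $k\to\infty$. $\eta$ acts on right-infinite words by $\eta(u_0u_1u_2\cdots)=\eta(u_0)\eta(u_1)\eta(u_2)\cdots$; $u$ is a periodic point if $\eta^p(u)=u$ for some $p\ge1$, and any such $p$ is called a period of $u$. A sequence $(m_i,a_i)_{i=0,\dots,k}$ in $A^*\times A$ is $x$-admissible if $m_{i-1}a_{i-1}$ is a prefix of $\eta(a_i)$ for all $1\le i\le k$ and $m_ka_k$ is a prefix of $\eta(x)$. -}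

module Defs where

open import Data.Nat using (ℕ; zero; suc; _≤_; _∸_)
open import Data.Fin using (Fin)
open import Data.List using (List; []; _∷_; _++_; [_]; concatMap; concat; length; map; take; drop; reverse; upTo)
open import Data.Product using (Σ; ∃; _×_; _,_; proj₁)
open import Data.Empty using (⊥)
open import Relation.Binary.PropositionalEquality using (_≡_; _≢_)

Alphabet : ℕ → Set
Alphabet N = Fin N

InfWord : Set → Set
InfWord A = ℕ → A

IsPrefix : {A : Set} → List A → List A → Set
IsPrefix {A} xs ys = Σ (List A) λ zs → xs ++ zs ≡ ys

ext : {A : Set} → (A → List A) → List A → List A
ext η w = concatMap η w

iter : {A : Set} → (A → List A) → ℕ → List A → List A
iter η zero w = w
iter η (suc k) w = ext η (iter η k w)

Growing : {A : Set} → (A → List A) → A → Set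
Growing η b = ∀ (M : ℕ) → ∃ λ K → ∀ k → K ≤ k → M ≤ length (iter η k [ b ])

IsSubstitution : {A : Set} → (A → List A) → Set
IsSubstitution {A} η = (∀ (b : A) → η b ≢ []) × (Σ A λ b → Growing η b)

prefix : {A : Set} → ℕ → InfWord A → List A
prefix n u = map u (upTo n)

-- The action of a morphism θ (with nonempty images) on infinite words:
-- θ(u) = θ(u_0)θ(u_1)θ(u_2)⋯ is the infinite word v such that, for every n,
-- θ(u_0 ⋯ u_{n-1}) is a prefix of v.
IsImageInf : {A : Set} → (List A → List A) → InfWord A → InfWord A → Set
IsImageInf θ u v = ∀ (n : ℕ) → θ (prefix n u) ≡ prefix (length (θ (prefix n u))) v

IsPeriodicPointWithPeriod : {A : Set} → (A → List A) → InfWord A → ℕ → Set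
IsPeriodicPointWithPeriod η u p = (1 ≤ p) × IsImageInf (iter η p) u u

-- A sequence (m_i, a_i)_{i=0..k} is represented as the list
-- (m_0,a_0) ∷ (m_1,a_1) ∷ ⋯ ∷ (m_k,a_k) ∷ [] (index 0 first; nonempty).
-- x-admissible: m_{i-1}a_{i-1} prefix of η(a_i) for 1 ≤ i ≤ k, and m_k a_k prefix of η(x).
Admissible : {A : Set} → (A → List A) → A → List (List A × A) → Set
Admissible η x [] = ⊥
Admissible η x ((m , b) ∷ []) = IsPrefix (m ++ [ b ]) (η x)
Admissible η x ((m , b) ∷ (m' , b') ∷ s) =
  IsPrefix (m ++ [ b ]) (η b') × Admissible η x ((m' , b') ∷ s)

-- For s = (m_0,a_0) ⋯ (m_{k-1},a_{k-1}):
-- expandFrom i s = η^{i+k-1}(m_{k-1}) ⋯ η^{i+1}(m_1) η^i(m_0).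
expandFrom : {A : Set} → (A → List A) → ℕ → List (List A × A) → List A
expandFrom η i [] = []
expandFrom η i ((m , b) ∷ s) = expandFrom η (suc i) s ++ iter η i m

expand : {A : Set} → (A → List A) → List (List A × A) → List A
expand η s = expandFrom η 0 s

-- m_{k-1} m_{k-2} ⋯ m_{k-p} for a sequence of length k ≥ p
lastBlock : {A : Set} → ℕ → List (List A × A) → List A
lastBlock p s = concat (reverse (map proj₁ (drop (length s ∸ p) s)))

Conditions : {A : Set} → (A → List A) → A → InfWord A → ℕ → ℕ → ℕ → List (List A × A) → Set
Conditions η a u n p k s =
  (length s ≡ k) × (p ≤ k) ×
  (Admissible η a s × lastBlock p s ≢ []) ×
  (prefix n u ≡ expand η s)

{-# OPTIONS --safe #-}
module Submission where

open import Defs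
open import Data.Nat using (ℕ; zero; suc; _+_; _*_; _∸_; _≤_; _<_; _≤′_; ≤′-refl; ≤′-step; z≤n; s≤s)
open import Data.Nat.Properties
open import Data.Nat.Divisibility using (_∣_; divides)
open import Data.List using (List; []; _∷_; _++_; [_]; _∷ʳ_; concat; length; map; reverse; drop; upTo)
open import Data.List.Properties
  using (++-assoc; ++-identityʳ; ++-cancelˡ; ++-conicalˡ; ++-conicalʳ; ∷-injectiveˡ; ∷-injectiveʳ;
         length-++; length-++-≤ˡ; length-++-sucʳ; length-map; length-applyUpTo; map-++; upTo-∷ʳ;
         concatMap-++; concat-++; unfold-reverse; reverse-involutive)
open import Data.Product using (Σ; ∃-syntax; _×_; _,_; proj₁; proj₂)
open import Data.Sum using (_⊎_; inj₁; inj₂)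
open import Data.Empty using (⊥; ⊥-elim)
open import Function using (id)
open import Function.Bundles using (_⇔_; mk⇔; Equivalence)
open import Relation.Nullary using (yes; no)
open import Relation.Binary.Definitions using (tri<; tri≈; tri>)
open import Relation.Binary.PropositionalEquality
  using (_≡_; _≢_; refl; sym; trans; cong; cong₂; subst; subst₂; module ≡-Reasoning)

open ≡-Reasoning

-- An a-admissible sequence of length k with first letter a₀ = c
-- expands to a word w such that w c is a prefix of η^k(a), and conversely every
-- such pair (w, c) comes from exactly one admissible sequence of length k; this
-- is proved by peeling off one application of η at a time (Dumont–Thomas).
-- Since η^p(a) begins with a, the words η^{jp}(a) are prefixes of u, of lengths
-- ℓ_j that increase strictly because a is growing.  For k = (j+1)p, the block
-- m_{k-1} ⋯ m_{k-p} is empty exactly when the top p terms contribute nothing to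
-- the expansion; then a_{k-p} = a and the expansion is shorter than ℓ_j, and
-- otherwise it begins with η^{jp}(a).  So condition (i) says ℓ_j ≤ n < ℓ_{j+1},
-- which determines j, and the sequence is then determined by the bijection.

module _ {A : Set} where

  ++-split : (xs ys zs ws : List A) → xs ++ ys ≡ zs ++ ws →
    (∃[ t ] (xs ≡ zs ++ t × ws ≡ t ++ ys)) ⊎
    (∃[ c ] ∃[ t ] (zs ≡ xs ++ c ∷ t × ys ≡ c ∷ t ++ ws))
  ++-split []       ys []       ws eq = inj₁ ([] , refl , sym eq)
  ++-split []       ys (z ∷ zs) ws eq = inj₂ (z , zs , refl , eq)
  ++-split (x ∷ xs) ys []       ws eq = inj₁ (x ∷ xs , refl , sym eq)
  ++-split (x ∷ xs) ys (z ∷ zs) ws eq with refl ← ∷-injectiveˡ eq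
    with ++-split xs ys zs ws (∷-injectiveʳ eq)
  ... | inj₁ (t , xs≡ , ws≡)     = inj₁ (t , cong (x ∷_) xs≡ , ws≡)
  ... | inj₂ (c , t , zs≡ , ys≡) = inj₂ (c , t , cong (x ∷_) zs≡ , ys≡)

  ++-∷-head : ∀ {w : List A} {c r y v} → w ++ c ∷ r ≡ y ∷ v →
    (w ≡ [] × c ≡ y) ⊎ ∃[ w′ ] w ≡ y ∷ w′
  ++-∷-head {[]}     eq = inj₁ (refl , ∷-injectiveˡ eq)
  ++-∷-head {x ∷ w′} eq = inj₂ (w′ , cong (_∷ w′) (∷-injectiveˡ eq))

  length-<-++-∷ : ∀ (w : List A) c r → length w < length (w ++ c ∷ r)
  length-<-++-∷ w c r = ≤-<-trans (length-++-≤ˡ w) (≤-reflexive (sym (length-++-sucʳ w c r)))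

  nonempty-length : ∀ {xs : List A} → xs ≢ [] → 1 ≤ length xs
  nonempty-length {[]}    xs≢[] = ⊥-elim (xs≢[] refl)
  nonempty-length {_ ∷ _} _     = s≤s z≤n

  IsPrefix-∷ʳ-length : ∀ {m : List A} {b w} → IsPrefix (m ++ [ b ]) w → length m < length w
  IsPrefix-∷ʳ-length {m} {b} (z , e) =
    subst (λ v → length m < length v) (trans (sym (++-assoc m [ b ] z)) e) (length-<-++-∷ m b z)

  IsPrefix-∷ʳ-unique : ∀ {m : List A} {b b′ w} → IsPrefix (m ++ [ b ]) w → IsPrefix (m ++ [ b′ ]) w →
    b ≡ b′
  IsPrefix-∷ʳ-unique {m} {b} {b′} (z , e) (z′ , e′) =
    ∷-injectiveˡ (++-cancelˡ m (b ∷ z) (b′ ∷ z′) (begin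
    m ++ b ∷ z          ≡⟨ ++-assoc m [ b ] z ⟨
    (m ++ [ b ]) ++ z   ≡⟨ trans e (sym e′) ⟩
    (m ++ [ b′ ]) ++ z′ ≡⟨ ++-assoc m [ b′ ] z′ ⟩
    m ++ b′ ∷ z′        ∎))

  ++-split-at : ∀ k {l} (s : List A) → length s ≡ k + l →
    ∃[ s₀ ] ∃[ t ] (s ≡ s₀ ++ t × length s₀ ≡ k × length t ≡ l)
  ++-split-at zero    s        ls = [] , s , refl , refl , ls
  ++-split-at (suc k) (x ∷ s)  ls =
    let s₀ , t , s≡ , ls₀ , lt = ++-split-at k s (suc-injective ls)
    in x ∷ s₀ , t , cong (x ∷_) s≡ , cong suc ls₀ , lt

  drop-length-++ : ∀ (s t : List A) → drop (length s) (s ++ t) ≡ t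
  drop-length-++ []      t = refl
  drop-length-++ (_ ∷ s) t = drop-length-++ s t

  reverse-concat-≡[]⁻ : ∀ (xss : List (List A)) → concat (reverse xss) ≡ [] → concat xss ≡ []
  reverse-concat-≡[]⁻ []         _ = refl
  reverse-concat-≡[]⁻ (xs ∷ xss) h = cong₂ _++_ (++-conicalˡ xs [] (++-conicalʳ (concat (reverse xss)) _ h′))
                                                (reverse-concat-≡[]⁻ xss (++-conicalˡ _ (xs ++ []) h′))
    where
    h′ : concat (reverse xss) ++ (xs ++ []) ≡ []
    h′ = trans (concat-++ (reverse xss) [ xs ]) (trans (cong concat (sym (unfold-reverse xs xss))) h)

  reverse-concat-≡[]⁺ : ∀ (xss : List (List A)) → concat xss ≡ [] → concat (reverse xss) ≡ []
  reverse-concat-≡[]⁺ xss h =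
    reverse-concat-≡[]⁻ (reverse xss) (subst (λ ys → concat ys ≡ []) (sym (reverse-involutive xss)) h)

lastBlock-++ : ∀ {A : Set} k (s t : List (List A × A)) → length t ≡ k →
  lastBlock k (s ++ t) ≡ concat (reverse (map proj₁ t))
lastBlock-++ _ s t refl = cong (λ v → concat (reverse (map proj₁ v))) (begin
  drop (length (s ++ t) ∸ length t) (s ++ t)
    ≡⟨ cong (λ i → drop (i ∸ length t) (s ++ t)) (length-++ s) ⟩
  drop (length s + length t ∸ length t) (s ++ t)
    ≡⟨ cong (λ i → drop i (s ++ t)) (m+n∸n≡m (length s) (length t)) ⟩
  drop (length s) (s ++ t)
    ≡⟨ drop-length-++ s t ⟩
  t  ∎)

module _ {A : Set} (u : InfWord A) where

  length-prefix : ∀ n → length (prefix n u) ≡ n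
  length-prefix n = trans (length-map u (upTo n)) (length-applyUpTo id n)

  prefix-suc : ∀ n → prefix (suc n) u ≡ prefix n u ∷ʳ u n
  prefix-suc n = trans (cong (map u) (sym (upTo-∷ʳ n))) (map-++ u (upTo n) [ n ])

  prefix-extend : ∀ {n m} → n < m → ∃[ r ] prefix n u ++ u n ∷ r ≡ prefix m u
  prefix-extend n<m = go (≤⇒≤′ n<m)
    where
    go : ∀ {n m} → suc n ≤′ m → ∃[ r ] prefix n u ++ u n ∷ r ≡ prefix m u
    go {n} ≤′-refl = [] , sym (prefix-suc n)
    go {n} (≤′-step {m} h) = let r , e = go h in r ∷ʳ u m , (begin
      prefix n u ++ u n ∷ (r ∷ʳ u m)  ≡⟨ ++-assoc (prefix n u) (u n ∷ r) [ u m ] ⟨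
      (prefix n u ++ u n ∷ r) ∷ʳ u m  ≡⟨ cong (_∷ʳ u m) e ⟩
      prefix m u ∷ʳ u m               ≡⟨ prefix-suc m ⟨
      prefix (suc m) u                ∎)

  image-prefix : ∀ (θ : List A → List A) → IsImageInf θ u u →
    ∀ w → w ≡ prefix (length w) u → θ w ≡ prefix (length (θ w)) u
  image-prefix θ img w w≡ = subst (λ v → θ v ≡ prefix (length (θ v)) u) (sym w≡) (img (length w))

module Morphism {A : Set} (η : A → List A) where

  iter-++ : ∀ i xs ys → iter η i (xs ++ ys) ≡ iter η i xs ++ iter η i ys
  iter-++ zero    xs ys = refl
  iter-++ (suc i) xs ys = trans (cong (ext η) (iter-++ i xs ys)) (concatMap-++ η (iter η i xs) (iter η i ys))

  iter-[] : ∀ i → iter η i [] ≡ []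
  iter-[] zero    = refl
  iter-[] (suc i) = cong (ext η) (iter-[] i)

  iter-+ : ∀ i j w → iter η (i + j) w ≡ iter η i (iter η j w)
  iter-+ zero    j w = refl
  iter-+ (suc i) j w = cong (ext η) (iter-+ i j w)

  length-iter-≥ : (∀ b → η b ≢ []) → ∀ i w → length w ≤ length (iter η i w)
  length-iter-≥ nonerasing zero    w = ≤-refl
  length-iter-≥ nonerasing (suc i) w = ≤-trans (length-iter-≥ nonerasing i w) (length-ext-≥ (iter η i w))
    where
    length-ext-≥ : ∀ v → length v ≤ length (ext η v)
    length-ext-≥ []      = z≤n
    length-ext-≥ (x ∷ v) = subst (suc (length v) ≤_) (sym (length-++ (η x)))
                                 (+-mono-≤ (nonempty-length (nonerasing x)) (length-ext-≥ v))

  iter-≡[]⁻ : (∀ b → η b ≢ []) → ∀ i {w} → iter η i w ≡ [] → w ≡ []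
  iter-≡[]⁻ nonerasing i {[]}    _ = refl
  iter-≡[]⁻ nonerasing i {x ∷ w} e
    with () ← subst (λ v → length (x ∷ w) ≤ length v) e (length-iter-≥ nonerasing i (x ∷ w))

  expandFrom-suc : ∀ i s → expandFrom η (suc i) s ≡ ext η (expandFrom η i s)
  expandFrom-suc i []            = refl
  expandFrom-suc i ((m , _) ∷ s) =
    trans (cong (_++ ext η (iter η i m)) (expandFrom-suc (suc i) s))
          (sym (concatMap-++ η (expandFrom η (suc i) s) (iter η i m)))

  expandFrom-iter : ∀ i s → expandFrom η i s ≡ iter η i (expand η s)
  expandFrom-iter zero    s = refl
  expandFrom-iter (suc i) s = trans (expandFrom-suc i s) (cong (ext η) (expandFrom-iter i s))

  expandFrom-++ : ∀ i s t → expandFrom η i (s ++ t) ≡ expandFrom η (length s + i) t ++ expandFrom η i s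
  expandFrom-++ i []            t = sym (++-identityʳ (expandFrom η i t))
  expandFrom-++ i ((m , _) ∷ s) t = begin
    expandFrom η (suc i) (s ++ t) ++ iter η i m
      ≡⟨ cong (_++ iter η i m) (expandFrom-++ (suc i) s t) ⟩
    (expandFrom η (length s + suc i) t ++ expandFrom η (suc i) s) ++ iter η i m
      ≡⟨ ++-assoc (expandFrom η (length s + suc i) t) _ _ ⟩
    expandFrom η (length s + suc i) t ++ expandFrom η (suc i) s ++ iter η i m
      ≡⟨ cong (λ l → expandFrom η l t ++ expandFrom η (suc i) s ++ iter η i m) (+-suc (length s) i) ⟩
    expandFrom η (suc (length s + i)) t ++ expandFrom η (suc i) s ++ iter η i m  ∎

  expand-++ : ∀ s t → expand η (s ++ t) ≡ iter η (length s) (expand η t) ++ expand η s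
  expand-++ s t = trans (expandFrom-++ 0 s t) (cong (_++ expand η s)
    (trans (cong (λ l → expandFrom η l t) (+-identityʳ (length s))) (expandFrom-iter (length s) t)))

  expandFrom-≡[]⁺ : ∀ i s → concat (map proj₁ s) ≡ [] → expandFrom η i s ≡ []
  expandFrom-≡[]⁺ i []            _ = refl
  expandFrom-≡[]⁺ i ((m , _) ∷ s) h =
    cong₂ _++_ (expandFrom-≡[]⁺ (suc i) s (++-conicalʳ m _ h))
               (trans (cong (iter η i) (++-conicalˡ m _ h)) (iter-[] i))

  expandFrom-≡[]⁻ : (∀ b → η b ≢ []) → ∀ i s → expandFrom η i s ≡ [] → concat (map proj₁ s) ≡ []
  expandFrom-≡[]⁻ nonerasing i []            _ = refl
  expandFrom-≡[]⁻ nonerasing i ((m , _) ∷ s) h =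
    cong₂ _++_ (iter-≡[]⁻ nonerasing i (++-conicalʳ _ (iter η i m) h))
               (expandFrom-≡[]⁻ nonerasing (suc i) s (++-conicalˡ _ (iter η i m) h))

  admissible-++⁻ʳ : ∀ {x m b} s t → Admissible η x (s ++ (m , b) ∷ t) → Admissible η x ((m , b) ∷ t)
  admissible-++⁻ʳ []          t adm       = adm
  admissible-++⁻ʳ (_ ∷ [])    t (_ , adm) = adm
  admissible-++⁻ʳ (_ ∷ e ∷ s) t (_ , adm) = admissible-++⁻ʳ (e ∷ s) t adm

  admissible-++⁻ˡ : ∀ {x e m b} s t → Admissible η x ((e ∷ s) ++ (m , b) ∷ t) → Admissible η b (e ∷ s)
  admissible-++⁻ˡ []      t (pre , _)   = pre
  admissible-++⁻ˡ (_ ∷ s) t (pre , adm) = pre , admissible-++⁻ˡ s t adm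

  desubstitute : ∀ V w c r → w ++ c ∷ r ≡ ext η V →
    ∃[ E ] ∃[ d ] ∃[ r′ ] ∃[ e ] (E ++ d ∷ r′ ≡ V × w ≡ ext η E ++ e × IsPrefix (e ++ [ c ]) (η d))
  desubstitute []      w c r eq with () ← ++-conicalʳ w (c ∷ r) eq
  desubstitute (v ∷ V) w c r eq with ++-split w (c ∷ r) (η v) (ext η V) eq
  ... | inj₁ (t , w≡ , t++c∷r≡) =
    let E , d , r′ , e , V≡ , t≡ , pre = desubstitute V t c r (sym t++c∷r≡)
    in v ∷ E , d , r′ , e , cong (v ∷_) V≡ ,
       trans w≡ (trans (cong (η v ++_) t≡) (sym (++-assoc (η v) (ext η E) e))) , pre
  ... | inj₂ (c′ , t , ηv≡ , c∷r≡) = [] , v , V , w , refl , refl , t , (begin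
    (w ++ [ c ]) ++ t  ≡⟨ ++-assoc w [ c ] t ⟩
    w ++ c ∷ t         ≡⟨ cong (λ x → w ++ x ∷ t) (∷-injectiveˡ c∷r≡) ⟩
    w ++ c′ ∷ t        ≡⟨ ηv≡ ⟨
    η v                ∎)

  image-overshoot : ∀ {E d e e′ c} t → ext η E ++ e ≡ ext η (E ++ d ∷ t) ++ e′ →
    IsPrefix (e ++ [ c ]) (η d) → ⊥
  image-overshoot {E} {d} {e} {e′} t w≡ pre = ≤⇒≯ ηd≤e (IsPrefix-∷ʳ-length pre)
    where
    e≡ : e ≡ η d ++ (ext η t ++ e′)
    e≡ = ++-cancelˡ (ext η E) e _ (begin
      ext η E ++ e                               ≡⟨ w≡ ⟩
      ext η (E ++ d ∷ t) ++ e′                   ≡⟨ cong (_++ e′) (concatMap-++ η E (d ∷ t)) ⟩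
      (ext η E ++ η d ++ ext η t) ++ e′          ≡⟨ ++-assoc (ext η E) _ e′ ⟩
      ext η E ++ (η d ++ ext η t) ++ e′          ≡⟨ cong (ext η E ++_) (++-assoc (η d) (ext η t) e′) ⟩
      ext η E ++ η d ++ ext η t ++ e′            ∎)
    ηd≤e : length (η d) ≤ length e
    ηd≤e = subst (λ v → length (η d) ≤ length v) (sym e≡) (length-++-≤ˡ (η d))

  desubstitute-unique : ∀ {E E′ d d′ r r′ e e′ c c′} → E ++ d ∷ r ≡ E′ ++ d′ ∷ r′ →
    ext η E ++ e ≡ ext η E′ ++ e′ →
    IsPrefix (e ++ [ c ]) (η d) → IsPrefix (e′ ++ [ c′ ]) (η d′) → E ≡ E′
  desubstitute-unique {E} {E′} {d} {d′} {r} {r′} V≡ w≡ pre pre′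
    with ++-split E (d ∷ r) E′ (d′ ∷ r′) V≡
  ... | inj₁ ([] , E≡ , _) = trans E≡ (++-identityʳ E′)
  ... | inj₁ (_ ∷ t , refl , d′∷r′≡) with refl ← ∷-injectiveˡ d′∷r′≡ =
    ⊥-elim (image-overshoot {E′} t (sym w≡) pre′)
  ... | inj₂ (_ , t , refl , d∷r≡) with refl ← ∷-injectiveˡ d∷r≡ =
    ⊥-elim (image-overshoot {E} t w≡ pre)

  admissible⇒prefix : ∀ {x m b} s → Admissible η x ((m , b) ∷ s) →
    ∃[ r ] expand η ((m , b) ∷ s) ++ b ∷ r ≡ iter η (suc (length s)) [ x ]
  admissible⇒prefix {x} {m} {b} [] (z , pre) =
    z , trans (sym (++-assoc m [ b ] z)) (trans pre (sym (++-identityʳ (η x))))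
  admissible⇒prefix {x} {m} {b} ((m′ , b′) ∷ s) ((z , pre) , adm) =
    let r , e = admissible⇒prefix s adm
        E = expand η ((m′ , b′) ∷ s)
    in z ++ ext η r , (begin
      (expandFrom η 1 ((m′ , b′) ∷ s) ++ m) ++ b ∷ z ++ ext η r
        ≡⟨ cong (λ v → (v ++ m) ++ b ∷ z ++ ext η r) (expandFrom-suc 0 ((m′ , b′) ∷ s)) ⟩
      (ext η E ++ m) ++ b ∷ z ++ ext η r
        ≡⟨ ++-assoc (ext η E) m _ ⟩
      ext η E ++ m ++ b ∷ z ++ ext η r
        ≡⟨ cong (ext η E ++_) (++-assoc m (b ∷ z) (ext η r)) ⟨
      ext η E ++ (m ++ b ∷ z) ++ ext η r
        ≡⟨ cong (λ v → ext η E ++ v ++ ext η r) (trans (sym (++-assoc m [ b ] z)) pre) ⟩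
      ext η E ++ η b′ ++ ext η r
        ≡⟨ concatMap-++ η E (b′ ∷ r) ⟨
      ext η (E ++ b′ ∷ r)
        ≡⟨ cong (ext η) e ⟩
      ext η (iter η (suc (length s)) [ x ])  ∎)

  prefix⇒admissible : ∀ {x} k w c r → w ++ c ∷ r ≡ iter η (suc k) [ x ] →
    ∃[ m ] ∃[ s ] (length s ≡ k × Admissible η x ((m , c) ∷ s) × expand η ((m , c) ∷ s) ≡ w)
  prefix⇒admissible {x} zero w c r eq =
    w , [] , refl , (r , trans (++-assoc w [ c ] r) (trans eq (++-identityʳ (η x)))) , refl
  prefix⇒admissible {x} (suc k) w c r eq =
    let E , d , r′ , e , V≡ , w≡ , pre = desubstitute (iter η (suc k) [ x ]) w c r eq
        m , s , ls , adm , E≡ = prefix⇒admissible k E d r′ V≡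
    in e , (m , d) ∷ s , cong suc ls , (pre , adm) , (begin
      expandFrom η 1 ((m , d) ∷ s) ++ e  ≡⟨ cong (_++ e) (expandFrom-suc 0 ((m , d) ∷ s)) ⟩
      ext η (expand η ((m , d) ∷ s)) ++ e ≡⟨ cong (λ v → ext η v ++ e) E≡ ⟩
      ext η E ++ e                       ≡⟨ w≡ ⟨
      w                                  ∎)

  -- both tails desubstitute the same prefix of η^k(x)
  tail-expand-unique : ∀ {x m b m′ b′ mc c mc′ c′} s t →
    Admissible η x ((m , b) ∷ (mc , c) ∷ s) → Admissible η x ((m′ , b′) ∷ (mc′ , c′) ∷ t) →
    length s ≡ length t →
    expand η ((m , b) ∷ (mc , c) ∷ s) ≡ expand η ((m′ , b′) ∷ (mc′ , c′) ∷ t) →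
    expand η ((mc , c) ∷ s) ≡ expand η ((mc′ , c′) ∷ t)
  tail-expand-unique {x} {m} {m′ = m′} {mc = mc} {c = c} {mc′ = mc′} {c′ = c′}
                     s t (pre , adm) (pre′ , adm′) len eq =
    desubstitute-unique
      (trans (proj₂ (admissible⇒prefix s adm))
        (trans (cong (λ l → iter η (suc l) [ x ]) len) (sym (proj₂ (admissible⇒prefix t adm′)))))
      (trans (cong (_++ m) (sym (expandFrom-suc 0 ((mc , c) ∷ s))))
        (trans eq (cong (_++ m′) (expandFrom-suc 0 ((mc′ , c′) ∷ t)))))
      pre pre′

  admissible-unique : ∀ {x} s t → Admissible η x s → Admissible η x t →
    length s ≡ length t → expand η s ≡ expand η t → s ≡ t
  admissible-unique []                []                 ()        _          _   _
  admissible-unique (_ ∷ _)           []                 _         ()         _   _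
  admissible-unique []                (_ ∷ _)            ()        _          _   _
  admissible-unique (_ ∷ [])          (_ ∷ _ ∷ _)        _         _          ()  _
  admissible-unique (_ ∷ _ ∷ _)       (_ ∷ [])           _         _          ()  _
  admissible-unique ((m , b) ∷ [])    ((m′ , b′) ∷ [])   pre       pre′       _   refl =
    cong (λ c → (m , c) ∷ []) (IsPrefix-∷ʳ-unique pre pre′)
  admissible-unique ((m , b) ∷ s@(_ ∷ _)) ((m′ , b′) ∷ t@(_ ∷ _)) (pre , adm) (pre′ , adm′) len eq
    with refl ← admissible-unique s t adm adm′ (suc-injective len)
                  (tail-expand-unique _ _ (pre , adm) (pre′ , adm′) (suc-injective (suc-injective len)) eq)
    with refl ← ++-cancelˡ (expandFrom η 1 s) m m′ eq
    = cong (λ c → (m , c) ∷ s) (IsPrefix-∷ʳ-unique pre pre′)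

  expansion-length< : ∀ {x} s → Admissible η x s → length (expand η s) < length (iter η (length s) [ x ])
  expansion-length< ((m , b) ∷ s) adm =
    let r , e = admissible⇒prefix s adm
    in subst (λ v → length (expand η ((m , b) ∷ s)) < length v) e
             (length-<-++-∷ (expand η ((m , b) ∷ s)) b r)

  expand-++-trivial< : ∀ {x m b} s t → Admissible η x (s ++ (m , b) ∷ t) → expand η ((m , b) ∷ t) ≡ [] →
    length (expand η (s ++ (m , b) ∷ t)) < length (iter η (length s) [ b ])
  expand-++-trivial< []      t _   T≡[] = subst (λ w → length w < 1) (sym T≡[]) (s≤s z≤n)
  expand-++-trivial< {m = m} {b} (e ∷ s) t adm T≡[] =
    subst (λ w → length w < length (iter η (length (e ∷ s)) [ b ])) (sym expand≡)
          (expansion-length< (e ∷ s) (admissible-++⁻ˡ s t adm))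
    where
    expand≡ : expand η ((e ∷ s) ++ (m , b) ∷ t) ≡ expand η (e ∷ s)
    expand≡ = begin
      expand η ((e ∷ s) ++ (m , b) ∷ t)
        ≡⟨ expand-++ (e ∷ s) ((m , b) ∷ t) ⟩
      iter η (length (e ∷ s)) (expand η ((m , b) ∷ t)) ++ expand η (e ∷ s)
        ≡⟨ cong (λ w → iter η (length (e ∷ s)) w ++ expand η (e ∷ s)) T≡[] ⟩
      iter η (length (e ∷ s)) [] ++ expand η (e ∷ s)
        ≡⟨ cong (_++ expand η (e ∷ s)) (iter-[] (length (e ∷ s))) ⟩
      expand η (e ∷ s)  ∎

  expand-++-≥ : ∀ {x w} s t → expand η t ≡ x ∷ w →
    length (iter η (length s) [ x ]) ≤ length (expand η (s ++ t))
  expand-++-≥ {x} {w} s t t≡ =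
    subst (λ v → length (iter η i [ x ]) ≤ length v) (sym expand≡) (length-++-≤ˡ (iter η i [ x ]))
    where
    i : ℕ
    i = length s
    expand≡ : expand η (s ++ t) ≡ iter η i [ x ] ++ iter η i w ++ expand η s
    expand≡ = begin
      expand η (s ++ t)                              ≡⟨ expand-++ s t ⟩
      iter η i (expand η t) ++ expand η s            ≡⟨ cong (λ v → iter η i v ++ expand η s) t≡ ⟩
      iter η i (x ∷ w) ++ expand η s                 ≡⟨ cong (_++ expand η s) (iter-++ i [ x ] w) ⟩
      (iter η i [ x ] ++ iter η i w) ++ expand η s   ≡⟨ ++-assoc (iter η i [ x ]) (iter η i w) (expand η s) ⟩
      iter η i [ x ] ++ iter η i w ++ expand η s     ∎

module _ (f : ℕ → ℕ) (f-strict : ∀ j → f j < f (suc j)) where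

  strict⇒monotone : ∀ {i j} → i ≤ j → f i ≤ f j
  strict⇒monotone i≤j = go (≤⇒≤′ i≤j)
    where
    go : ∀ {i j} → i ≤′ j → f i ≤ f j
    go ≤′-refl        = ≤-refl
    go (≤′-step i≤′j) = ≤-trans (go i≤′j) (<⇒≤ (f-strict _))

  bracket : ∀ n → f 0 ≤ n → ∃[ j ] (f j ≤ n × n < f (suc j))
  bracket zero    f0≤0 = 0 , f0≤0 , ≤-<-trans z≤n (f-strict 0)
  bracket (suc n) f0≤1+n with f 0 ≤? n
  ... | no  f0≰n = 0 , f0≤1+n , ≤-<-trans (≰⇒> f0≰n) (f-strict 0)
  ... | yes f0≤n with bracket n f0≤n
  ...   | j , fj≤n , n<fj+1 with suc n <? f (suc j)
  ...     | yes 1+n<fj+1 = j , m≤n⇒m≤1+n fj≤n , 1+n<fj+1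
  ...     | no  1+n≮fj+1 = suc j , ≮⇒≥ 1+n≮fj+1 , ≤-<-trans n<fj+1 (f-strict (suc j))

  bracket-unique : ∀ {n i j} → f i ≤ n → n < f (suc i) → f j ≤ n → n < f (suc j) → i ≡ j
  bracket-unique {i = i} {j} fi≤n n<fi+1 fj≤n n<fj+1 with <-cmp i j
  ... | tri< i<j _ _ = ⊥-elim (<⇒≱ n<fi+1 (≤-trans (strict⇒monotone i<j) fj≤n))
  ... | tri≈ _ i≡j _ = i≡j
  ... | tri> _ _ j<i = ⊥-elim (<⇒≱ n<fj+1 (≤-trans (strict⇒monotone j<i) fi≤n))

module PeriodicPoint {A : Set} (η : A → List A) (nonerasing : ∀ b → η b ≢ []) {a : A} (growing : Growing η a)
  (u : InfWord A) (p′ : ℕ) (periodic : IsImageInf (iter η (suc p′)) u u) (u₀≡a : u 0 ≡ a) where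

  open Morphism η

  p : ℕ
  p = suc p′

  ℓ : ℕ → ℕ
  ℓ j = length (iter η (j * p) [ a ])

  iter-prefix : ∀ j → iter η (j * p) [ a ] ≡ prefix (ℓ j) u
  iter-prefix zero    = cong [_] (sym u₀≡a)
  iter-prefix (suc j) = begin
    iter η (p + j * p) [ a ]
      ≡⟨ iter-+ p (j * p) [ a ] ⟩
    iter η p (iter η (j * p) [ a ])
      ≡⟨ image-prefix u (iter η p) periodic _ (iter-prefix j) ⟩
    prefix (length (iter η p (iter η (j * p) [ a ]))) u
      ≡⟨ cong (λ w → prefix (length w) u) (iter-+ p (j * p) [ a ]) ⟨
    prefix (ℓ (suc j)) u  ∎

  iter-p-head : ∃[ w ] iter η p [ a ] ≡ a ∷ w
  iter-p-head
    with iter η p [ a ] | image-prefix u (iter η p) periodic [ a ] (iter-prefix 0) | length-iter-≥ nonerasing p [ a ]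
  ... | []    | _ | ()
  ... | x ∷ w | e | _ = w , cong (_∷ w) (trans (∷-injectiveˡ e) u₀≡a)

  w₀ : List A
  w₀ = proj₁ iter-p-head

  -- otherwise η^{jp}(a) = a for all j, and a would not be growing
  w₀≢[] : w₀ ≢ []
  w₀≢[] w₀≡[] = <-irrefl refl 2≤1
    where
    stuck : ∀ j → iter η (j * p) [ a ] ≡ [ a ]
    stuck zero    = refl
    stuck (suc j) = trans (iter-+ p (j * p) [ a ])
      (trans (cong (iter η p) (stuck j)) (trans (proj₂ iter-p-head) (cong (a ∷_) w₀≡[])))
    K : ℕ
    K = proj₁ (growing 2)
    2≤1 : 2 ≤ 1
    2≤1 = subst (λ w → 2 ≤ length w) (stuck K) (proj₂ (growing 2) (K * p) (m≤m*n K p))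

  ℓ-strict : ∀ j → ℓ j < ℓ (suc j)
  ℓ-strict j = subst (ℓ j <_) (trans (sym (length-++ (iter η (j * p) [ a ]))) (cong length (sym iter≡)))
    (m<m+n (ℓ j) (≤-trans (nonempty-length w₀≢[]) (length-iter-≥ nonerasing (j * p) w₀)))
    where
    iter≡ : iter η (suc j * p) [ a ] ≡ iter η (j * p) [ a ] ++ iter η (j * p) w₀
    iter≡ = begin
      iter η (p + j * p) [ a ]         ≡⟨ cong (λ i → iter η i [ a ]) (+-comm p (j * p)) ⟩
      iter η (j * p + p) [ a ]         ≡⟨ iter-+ (j * p) p [ a ] ⟩
      iter η (j * p) (iter η p [ a ])  ≡⟨ cong (iter η (j * p)) (proj₂ iter-p-head) ⟩
      iter η (j * p) (a ∷ w₀)          ≡⟨ iter-++ (j * p) [ a ] w₀ ⟩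
      iter η (j * p) [ a ] ++ iter η (j * p) w₀ ∎

  top-block : ∀ {m b} t → length t ≡ p′ → Admissible η a ((m , b) ∷ t) →
    (expand η ((m , b) ∷ t) ≡ [] × b ≡ a) ⊎ ∃[ w ] expand η ((m , b) ∷ t) ≡ a ∷ w
  top-block t lt adm = let r , e = admissible⇒prefix t adm in
    ++-∷-head (trans e (trans (cong (λ l → iter η (suc l) [ a ]) lt) (proj₂ iter-p-head)))

  lastBlock≢[]⇔ : ∀ j s → length s ≡ suc j * p → Admissible η a s →
    lastBlock p s ≢ [] ⇔ ℓ j ≤ length (expand η s)
  lastBlock≢[]⇔ j s ls adm with ++-split-at (j * p) s (trans ls (+-comm p (j * p)))
  ... | s₀ , (m , b) ∷ t , refl , ls₀ , lt = mk⇔ long short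
    where
    T : List (List A × A)
    T = (m , b) ∷ t
    admT : Admissible η a T
    admT = admissible-++⁻ʳ s₀ t adm
    lastBlock≡ : lastBlock p (s₀ ++ T) ≡ concat (reverse (map proj₁ T))
    lastBlock≡ = lastBlock-++ p s₀ T lt
    long : lastBlock p (s₀ ++ T) ≢ [] → ℓ j ≤ length (expand η (s₀ ++ T))
    long lb≢[] with top-block t (suc-injective lt) admT
    ... | inj₁ (T≡[] , _) =
      ⊥-elim (lb≢[] (trans lastBlock≡
        (reverse-concat-≡[]⁺ (map proj₁ T) (expandFrom-≡[]⁻ nonerasing 0 T T≡[]))))
    ... | inj₂ (_ , T≡a∷w) =
      subst (λ i → length (iter η i [ a ]) ≤ length (expand η (s₀ ++ T))) ls₀ (expand-++-≥ s₀ T T≡a∷w)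
    short : ℓ j ≤ length (expand η (s₀ ++ T)) → lastBlock p (s₀ ++ T) ≢ []
    short ℓj≤ lb≡[] with top-block t (suc-injective lt) admT
    ... | inj₁ (T≡[] , refl) =
      <⇒≱ (subst (λ i → length (expand η (s₀ ++ T)) < length (iter η i [ a ])) ls₀
                 (expand-++-trivial< s₀ t adm T≡[])) ℓj≤
    ... | inj₂ (_ , T≡a∷w) with () ← trans (sym T≡a∷w)
      (expandFrom-≡[]⁺ 0 T (reverse-concat-≡[]⁻ (map proj₁ T) (trans (sym lastBlock≡) lb≡[])))

  representation : ∀ {n} j → ℓ j ≤ n → n < ℓ (suc j) → ∃[ s ] Conditions η a u n p (suc j * p) s
  representation {n} j ℓj≤n n<ℓj+1 =
    let r , pre = prefix-extend u n<ℓj+1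
        m , s , ls , adm , e =
          prefix⇒admissible (p′ + j * p) (prefix n u) (u n) r (trans pre (sym (iter-prefix (suc j))))
        S = (m , u n) ∷ s
        n≡ = trans (sym (length-prefix u n)) (cong length (sym e))
    in S , cong suc ls , m≤m+n p (j * p) ,
       (adm , Equivalence.from (lastBlock≢[]⇔ j S (cong suc ls) adm) (subst (ℓ j ≤_) n≡ ℓj≤n)) , sym e

  solution-index : ∀ {n k s} → p ∣ k → Conditions η a u n p k s →
    ∃[ j ] (k ≡ suc j * p × ℓ j ≤ n × n < ℓ (suc j))
  solution-index (divides zero    refl) (_ , () , _)
  solution-index {n} {s = s} (divides (suc j) refl) (ls , _ , (adm , lb≢[]) , e) =
    j , refl , subst (ℓ j ≤_) n≡ (Equivalence.to (lastBlock≢[]⇔ j s ls adm) lb≢[]) ,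
    subst₂ _<_ n≡ (cong (λ l → length (iter η l [ a ])) ls) (expansion-length< s adm)
    where
    n≡ : length (expand η s) ≡ n
    n≡ = trans (cong length (sym e)) (length-prefix u n)

  solution-unique : ∀ {n} j {s k′ s′} → ℓ j ≤ n → n < ℓ (suc j) → Conditions η a u n p (suc j * p) s →
    p ∣ k′ → Conditions η a u n p k′ s′ → k′ ≡ suc j * p × s′ ≡ s
  solution-unique j {s} {s′ = s′} ℓj≤n n<ℓj+1 (ls , _ , (adm , _) , e) p∣k′
                  conditions′@(ls′ , _ , (adm′ , _) , e′)
    with solution-index p∣k′ conditions′
  ... | j′ , refl , ℓj′≤n , n<ℓj′+1
    with refl ← bracket-unique ℓ ℓ-strict {i = j} {j′} ℓj≤n n<ℓj+1 ℓj′≤n n<ℓj′+1 =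
    refl , admissible-unique s′ s adm′ adm (trans ls′ (sym ls)) (trans (sym e′) e)

theorem11 : (N : ℕ) (η : Alphabet N → List (Alphabet N)) → IsSubstitution η →
    (a : Alphabet N) → Growing η a →
    (u : InfWord (Alphabet N)) (p : ℕ) → IsPeriodicPointWithPeriod η u p → u 0 ≡ a →
    (n : ℕ) → 1 ≤ n →
    Σ ℕ λ k → Σ (List (List (Alphabet N) × Alphabet N)) λ s →
      (p ∣ k × Conditions η a u n p k s) ×
      (∀ (k′ : ℕ) (s′ : List (List (Alphabet N) × Alphabet N)) →
        p ∣ k′ × Conditions η a u n p k′ s′ → (k′ ≡ k × s′ ≡ s))
theorem11 N η (nonerasing , _) a growing u zero     (() , _)       u₀≡a n 1≤n
theorem11 N η (nonerasing , _) a growing u (suc p′) (_ , periodic) u₀≡a n 1≤n =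
  let open PeriodicPoint η nonerasing growing u p′ periodic u₀≡a
      j , ℓj≤n , n<ℓj+1 = bracket ℓ ℓ-strict n 1≤n
      s , conditions = representation j ℓj≤n n<ℓj+1
  in suc j * p , s , (divides (suc j) refl , conditions) ,
     λ k′ s′ (p∣k′ , conditions′) → solution-unique j ℓj≤n n<ℓj+1 conditions p∣k′ conditions′
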